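{- Let $t,s$ be $\lambda$-terms with $t\multimap_h^* s$. Then there is a term $s'$ such that $t\to_h^* s'$ and $s\to_h^* s'$.
   Context: $\lambda$-terms: $s,t ::= x \mid \lambda x.t \mid st$, modulo $\alpha$-conversion with the distinct names convention; $t\{s/x\}$ is capture-avoiding substitution. Contexts have one hole $\square$, plugging is without renaming. H-contexts: $H ::= \square \mid \lambda x.H \mid H\,t$. E-contexts: $E ::= \square \mid E_1[\lambda x.E_2]\,t$ ($E_1,E_2$ E-contexts). Head reduction $\to_h$: $\lambda y_1.\ldots\lambda y_k.(\lambda x.t)s\,u_1\ldots u_h\to_h\lambda y_1.\ldots\lambda y_k.\,t\{s/x\}\,u_1\ldots u_h$ ($k,h\ge 0$). Linear head reduction $\multimap_h$ is the least relation containing the rule $E[\lambda x.H[x]]\,s\multimap_h E[\lambda x.H[s']]\,s$, where $E$ is an E-context, $H$ an H-context, the displayed $x$ is the occurrence in the hole of $H$ (bound by the displayed $\lambda x$), and $s'$ is a fresh copy of $s$ (all bound variables renamed to new names), and closed under H-contexts (if $u\multimap_h u'$ then $H[u]\multimap_h H[u']$ for every H-context $H$). $^*$ denotes reflexive-transitive closure. -}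

module Defs where

open import Data.Nat using (ℕ; zero; suc; _+_; _∸_; _<ᵇ_; _≡ᵇ_)
open import Data.Bool using (if_then_else_)

-- λ-terms modulo α-conversion, represented with de Bruijn indices
data Term : Set where
  var : ℕ → Term
  lam : Term → Term
  app : Term → Term → Term

shift : ℕ → ℕ → Term → Term
shift c d (var n)   = if n <ᵇ c then var n else var (n + d)
shift c d (lam t)   = lam (shift (suc c) d t)
shift c d (app t u) = app (shift c d t) (shift c d u)

-- subst j s t : capture-avoiding substitution of s for index j in t,
-- removing the binder of j (indices above j are decremented)
subst : ℕ → Term → Term → Term
subst j s (var n)   = if n ≡ᵇ j then s else (if n <ᵇ j then var n else var (n ∸ 1))
subst j s (lam t)   = lam (subst (suc j) (shift 0 1 s) t)
subst j s (app t u) = app (subst j s t) (subst j s u)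

-- t{s/x} where x is the variable bound by the outermost λ of λx.t
_[_] : Term → Term → Term
t [ s ] = subst 0 s t

-- Head reduction: λy₁…λy_k.(λx.t) s u₁…u_h →h λy₁…λy_k. t{s/x} u₁…u_h
data _→a_ : Term → Term → Set where
  β    : ∀ {t s} → app (lam t) s →a (t [ s ])
  appL : ∀ {t t' u} → t →a t' → app t u →a app t' u

data _→h_ : Term → Term → Set where
  base : ∀ {t t'} → t →a t' → t →h t'
  lamH : ∀ {t t'} → t →h t' → lam t →h lam t'

data HCtx : Set where
  □    : HCtx
  hlam : HCtx → HCtx
  happ : HCtx → Term → HCtx

plugH : HCtx → Term → Term
plugH □          u = u
plugH (hlam H)   u = lam (plugH H u)
plugH (happ H t) u = app (plugH H u) t

bindH : HCtx → ℕ
bindH □          = 0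
bindH (hlam H)   = suc (bindH H)
bindH (happ H t) = bindH H

data ECtx : Set where
  □    : ECtx
  eapp : ECtx → ECtx → Term → ECtx

plugE : ECtx → Term → Term
plugE □               u = u
plugE (eapp E₁ E₂ t) u = app (plugE E₁ (lam (plugE E₂ u))) t

bindE : ECtx → ℕ
bindE □               = 0
bindE (eapp E₁ E₂ t) = bindE E₁ + suc (bindE E₂)

-- Root rule: E[λx.H[x]] s ⊸h E[λx.H[s']] s.  The occurrence x in the hole of H
-- bound by the displayed λx has index bindH H; the copy s' is s with its free
-- variables shifted past the binders of E, λx and H (plugging without renaming
-- plus the distinct-names convention means no capture).
data _⊸h_ : Term → Term → Set where
  root : ∀ (E : ECtx) (H : HCtx) (s : Term) →
         app (plugE E (lam (plugH H (var (bindH H))))) s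
           ⊸h app (plugE E (lam (plugH H (shift 0 (bindE E + suc (bindH H)) s)))) s
  ctx  : ∀ (H : HCtx) {u u'} → u ⊸h u' → plugH H u ⊸h plugH H u'

module Submission where

-- A linear head step replaces the occurrence x in E[λx.H[x]] s by a copy of s.  Both
-- sides then head-reduce in lockstep: as long as the head redex lies in the outer
-- H-context or in the spine E, the same contraction happens on both sides and acts on
-- them by one substitution, which preserves the shape of the linear redex (a contraction
-- in E removes a binder of E, which the copy of s was shifted past).  When λx itself is
-- contracted, x and the copy both become s, so the two sides meet.  Head reduction is
-- deterministic, hence joinability is transitive and extends to ⊸h-sequences.

open import Data.Bool using (true; false)
open import Data.Nat using (ℕ; suc; _+_; _∸_; _<ᵇ_; _≡ᵇ_; _≤_; _<_; z≤n; s≤s; z<s)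
open import Data.Nat.Induction using (<-wellFounded)
open import Data.Nat.Properties
open import Data.Nat.Tactic.RingSolver using (solve-∀)
open import Data.Product using (∃; _×_; _,_)
open import Function using (_∘_)
open import Induction.WellFounded using (Acc; acc)
open import Relation.Binary.Construct.Closure.ReflexiveTransitive using (Star; ε; _◅_; _◅◅_; fold)
open import Relation.Binary.Definitions using (tri<; tri≈; tri>)
open import Relation.Binary.PropositionalEquality
  using (_≡_; refl; sym; trans; cong; cong₂; module ≡-Reasoning) renaming (subst to ≡-subst)
open import Relation.Binary.Rewriting using (Deterministic; det⇒conf)
open import Relation.Nullary using (yes; no; contradiction)

open import Defs

shift-var-< : ∀ {c d n} → n < c → shift c d (var n) ≡ var n
shift-var-< {c} {n = n} n<c with n <ᵇ c | <⇒<ᵇ n<c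
... | true | _ = refl

shift-var-≥ : ∀ {c d n} → c ≤ n → shift c d (var n) ≡ var (n + d)
shift-var-≥ {c} {n = n} c≤n with n <ᵇ c | <ᵇ⇒< n c
... | false | _   = refl
... | true  | n<c = contradiction (n<c _) (≤⇒≯ c≤n)

subst-var-≡ : ∀ {j v} → subst j v (var j) ≡ v
subst-var-≡ {j} with j ≡ᵇ j | ≡⇒≡ᵇ j j refl
... | true | _ = refl

subst-var-< : ∀ {j v n} → n < j → subst j v (var n) ≡ var n
subst-var-< {j} {n = n} n<j with n ≡ᵇ j | ≡ᵇ⇒≡ n j | n <ᵇ j | <⇒<ᵇ n<j
... | true  | n≡j | _    | _ = contradiction (n≡j _) (<⇒≢ n<j)
... | false | _   | true | _ = refl

subst-var-> : ∀ {j v n} → j < n → subst j v (var n) ≡ var (n ∸ 1)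
subst-var-> {j} {n = n} j<n with n ≡ᵇ j | ≡ᵇ⇒≡ n j | n <ᵇ j | <ᵇ⇒< n j
... | true  | n≡j | _     | _   = contradiction (n≡j _) (>⇒≢ j<n)
... | false | _   | true  | n<j = contradiction (n<j _) (<⇒≯ j<n)
... | false | _   | false | _   = refl

shift-identity : ∀ c t → shift c 0 t ≡ t
shift-identity c (var n) with n <? c
... | yes n<c = shift-var-< n<c
... | no  n≮c = trans (shift-var-≥ (≮⇒≥ n≮c)) (cong var (+-identityʳ n))
shift-identity c (lam t)   = cong lam (shift-identity (suc c) t)
shift-identity c (app t u) = cong₂ app (shift-identity c t) (shift-identity c u)

shift-shift : ∀ c a b t → shift c a (shift c b t) ≡ shift c (b + a) t
shift-shift c a b (var n) with n <? c
... | yes n<c rewrite shift-var-< {c} {b} n<c | shift-var-< {c} {a} n<c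
                    | shift-var-< {c} {b + a} n<c = refl
... | no  n≮c rewrite shift-var-≥ {c} {b} (≮⇒≥ n≮c)
                    | shift-var-≥ {c} {a} (≤-trans (≮⇒≥ n≮c) (m≤m+n n b))
                    | shift-var-≥ {c} {b + a} (≮⇒≥ n≮c) = cong var (+-assoc n b a)
shift-shift c a b (lam t)   = cong lam (shift-shift (suc c) a b t)
shift-shift c a b (app t u) = cong₂ app (shift-shift c a b t) (shift-shift c a b u)

shift-comm : ∀ c' c d v → c' ≤ c → shift c' 1 (shift c d v) ≡ shift (suc c) d (shift c' 1 v)
shift-comm c' c d (var n) c'≤c with n <? c' | n <? c
... | yes n<c' | _ rewrite shift-var-< {c} {d} (<-≤-trans n<c' c'≤c) | shift-var-< {c'} {1} n<c'
                         | shift-var-< {suc c} {d} (m<n⇒m<1+n (<-≤-trans n<c' c'≤c)) = refl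
... | no  n≮c' | yes n<c rewrite shift-var-< {c} {d} n<c | shift-var-≥ {c'} {1} (≮⇒≥ n≮c')
                               | +-comm n 1 | shift-var-< {suc c} {d} (s≤s n<c) = refl
... | no  n≮c' | no  n≮c rewrite shift-var-≥ {c} {d} (≮⇒≥ n≮c)
                               | shift-var-≥ {c'} {1} (≤-trans (≮⇒≥ n≮c') (m≤m+n n d))
                               | shift-var-≥ {c'} {1} (≮⇒≥ n≮c') | +-comm n 1
                               | shift-var-≥ {suc c} {d} (s≤s (≮⇒≥ n≮c)) = cong var (+-comm (n + d) 1)
shift-comm c' c d (lam t)   c'≤c = cong lam (shift-comm (suc c') (suc c) d t (s≤s c'≤c))
shift-comm c' c d (app t u) c'≤c = cong₂ app (shift-comm c' c d t c'≤c) (shift-comm c' c d u c'≤c)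

subst-shift-gap : ∀ c j d v t → c ≤ j → j ≤ c + d → subst j v (shift c (suc d) t) ≡ shift c d t
subst-shift-gap c j d v (var n) c≤j j≤c+d with n <? c
... | yes n<c rewrite shift-var-< {c} {suc d} n<c | subst-var-< {j} {v} (<-≤-trans n<c c≤j)
                    | shift-var-< {c} {d} n<c = refl
... | no  n≮c rewrite shift-var-≥ {c} {suc d} (≮⇒≥ n≮c) | shift-var-≥ {c} {d} (≮⇒≥ n≮c) | +-suc n d
                    | subst-var-> {j} {v} (s≤s (≤-trans j≤c+d (+-monoˡ-≤ d (≮⇒≥ n≮c)))) = refl
subst-shift-gap c j d v (lam t) c≤j j≤c+d =
  cong lam (subst-shift-gap (suc c) (suc j) d (shift 0 1 v) t (s≤s c≤j) (s≤s j≤c+d))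
subst-shift-gap c j d v (app t u) c≤j j≤c+d =
  cong₂ app (subst-shift-gap c j d v t c≤j j≤c+d) (subst-shift-gap c j d v u c≤j j≤c+d)

subst-shift-comm : ∀ c d j v t → c ≤ j →
  subst (d + j) (shift c d v) (shift c d t) ≡ shift c d (subst j v t)
subst-shift-comm c d j v (var n) c≤j rewrite +-comm d j with n <? c | <-cmp n j
... | yes n<c | _ rewrite subst-var-< {j} {v} (<-≤-trans n<c c≤j) | shift-var-< {c} {d} n<c
                        | subst-var-< {j + d} {shift c d v} (<-≤-trans n<c (≤-trans c≤j (m≤m+n j d))) = refl
... | no n≮c | tri< n<j _ _ rewrite subst-var-< {j} {v} n<j | shift-var-≥ {c} {d} (≮⇒≥ n≮c)
                                  | subst-var-< {j + d} {shift c d v} (+-monoˡ-< d n<j) = refl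
... | no n≮c | tri≈ _ refl _ rewrite subst-var-≡ {n} {v} | shift-var-≥ {c} {d} (≮⇒≥ n≮c)
                                   | subst-var-≡ {n + d} {shift c d v} = refl
... | no n≮c | tri> _ _ j<n rewrite subst-var-> {j} {v} j<n | shift-var-≥ {c} {d} (≮⇒≥ n≮c)
                                  | shift-var-≥ {c} {d} (≤-trans c≤j (∸-monoˡ-≤ 1 j<n))
                                  | subst-var-> {j + d} {shift c d v} (+-monoˡ-< d j<n)
  = cong var (+-∸-comm d (≤-trans (s≤s z≤n) j<n))
subst-shift-comm c d j v (lam t) c≤j =
  cong lam (trans (cong₂ (λ i w → subst i w (shift (suc c) d t)) (sym (+-suc d j)) (shift-comm 0 c d v z≤n))
                  (subst-shift-comm (suc c) d (suc j) (shift 0 1 v) t (s≤s c≤j)))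
subst-shift-comm c d j v (app t u) c≤j =
  cong₂ app (subst-shift-comm c d j v t c≤j) (subst-shift-comm c d j v u c≤j)

m+1+[n+o]≡n+1+m+o : ∀ m n o → m + suc (n + o) ≡ n + suc m + o
m+1+[n+o]≡n+1+m+o = solve-∀

shift-shift-suc : ∀ k b v → shift 0 k (shift 0 1 (shift 0 b v)) ≡ shift 0 (b + suc k) v
shift-shift-suc k b v = trans (shift-shift 0 k 1 (shift 0 b v)) (shift-shift 0 (suc k) b v)

substH : ℕ → Term → HCtx → HCtx
substH j v □          = □
substH j v (hlam H)   = hlam (substH (suc j) (shift 0 1 v) H)
substH j v (happ H t) = happ (substH j v H) (subst j v t)

bindH-substH : ∀ j v H → bindH (substH j v H) ≡ bindH H
bindH-substH j v □          = refl
bindH-substH j v (hlam H)   = cong suc (bindH-substH (suc j) (shift 0 1 v) H)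
bindH-substH j v (happ H t) = bindH-substH j v H

sizeH : HCtx → ℕ
sizeH □          = 0
sizeH (hlam H)   = suc (sizeH H)
sizeH (happ H t) = suc (sizeH H)

sizeH-substH : ∀ j v H → sizeH (substH j v H) ≡ sizeH H
sizeH-substH j v □          = refl
sizeH-substH j v (hlam H)   = cong suc (sizeH-substH (suc j) (shift 0 1 v) H)
sizeH-substH j v (happ H t) = cong suc (sizeH-substH j v H)

subst-plugH : ∀ j v H w →
  subst j v (plugH H w) ≡ plugH (substH j v H) (subst (bindH H + j) (shift 0 (bindH H) v) w)
subst-plugH j v □          w = cong (λ v' → subst j v' w) (sym (shift-identity 0 v))
subst-plugH j v (hlam H)   w = cong lam (trans (subst-plugH (suc j) (shift 0 1 v) H w)
  (cong₂ (λ i v' → plugH (substH (suc j) (shift 0 1 v) H) (subst i v' w))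
         (+-suc (bindH H) j) (shift-shift 0 (bindH H) 1 v)))
subst-plugH j v (happ H t) w = cong (λ f → app f (subst j v t)) (subst-plugH j v H w)

substE : ℕ → Term → ECtx → ECtx
substE j v □              = □
substE j v (eapp E₁ E₂ t) =
  eapp (substE j v E₁) (substE (suc (bindE E₁ + j)) (shift 0 1 (shift 0 (bindE E₁) v)) E₂) (subst j v t)

bindE-substE : ∀ j v E → bindE (substE j v E) ≡ bindE E
bindE-substE j v □              = refl
bindE-substE j v (eapp E₁ E₂ t) =
  cong₂ (λ b₁ b₂ → b₁ + suc b₂) (bindE-substE j v E₁) (bindE-substE _ _ E₂)

subst-plugE : ∀ j v E w →
  subst j v (plugE E w) ≡ plugE (substE j v E) (subst (bindE E + j) (shift 0 (bindE E) v) w)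
subst-plugE j v □              w = cong (λ v' → subst j v' w) (sym (shift-identity 0 v))
subst-plugE j v (eapp E₁ E₂ t) w = cong (λ f → app f (subst j v t)) (begin
  subst j v (plugE E₁ (lam (plugE E₂ w)))
    ≡⟨ subst-plugE j v E₁ _ ⟩
  plugE E₁' (lam (subst (suc (b₁ + j)) v₁ (plugE E₂ w)))
    ≡⟨ cong (plugE E₁' ∘ lam) (subst-plugE (suc (b₁ + j)) v₁ E₂ w) ⟩
  plugE E₁' (lam (plugE E₂' (subst (b₂ + suc (b₁ + j)) (shift 0 b₂ v₁) w)))
    ≡⟨ cong₂ (λ i v' → plugE E₁' (lam (plugE E₂' (subst i v' w))))
             (m+1+[n+o]≡n+1+m+o b₂ b₁ j) (shift-shift-suc b₂ b₁ v) ⟩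
  plugE E₁' (lam (plugE E₂' (subst (b₁ + suc b₂ + j) (shift 0 (b₁ + suc b₂) v) w))) ∎)
  where
    open ≡-Reasoning
    b₁ = bindE E₁
    b₂ = bindE E₂
    v₁ = shift 0 1 (shift 0 b₁ v)
    E₁' = substE j v E₁
    E₂' = substE (suc (b₁ + j)) v₁ E₂

record LinearRedex : Set where
  constructor redex
  field
    spine : ECtx
    body  : HCtx
    arg   : Term

before after : LinearRedex → Term
before (redex E H s) = app (plugE E (lam (plugH H (var (bindH H))))) s
after  (redex E H s) = app (plugE E (lam (plugH H (shift 0 (bindE E + suc (bindH H)) s)))) s

substRedex : ℕ → Term → LinearRedex → LinearRedex
substRedex j v (redex E H s) =
  redex (substE j v E) (substH (suc (bindE E + j)) (shift 0 1 (shift 0 (bindE E) v)) H) (subst j v s)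

subst-before : ∀ j v ρ → subst j v (before ρ) ≡ before (substRedex j v ρ)
subst-before j v (redex E H s) = cong (λ f → app f (subst j v s)) (begin
  subst j v (plugE E (lam (plugH H (var k))))
    ≡⟨ subst-plugE j v E _ ⟩
  plugE E' (lam (subst (suc (bindE E + j)) v' (plugH H (var k))))
    ≡⟨ cong (plugE E' ∘ lam) (subst-plugH _ v' H (var k)) ⟩
  plugE E' (lam (plugH H' (subst (k + suc (bindE E + j)) (shift 0 k v') (var k))))
    ≡⟨ cong (plugE E' ∘ lam ∘ plugH H') (subst-var-< (m<m+n k z<s)) ⟩
  plugE E' (lam (plugH H' (var k)))
    ≡⟨ cong (plugE E' ∘ lam ∘ plugH H' ∘ var) (bindH-substH _ v' H) ⟨
  plugE E' (lam (plugH H' (var (bindH H')))) ∎)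
  where
    open ≡-Reasoning
    k = bindH H
    v' = shift 0 1 (shift 0 (bindE E) v)
    E' = substE j v E
    H' = substH (suc (bindE E + j)) v' H

subst-after : ∀ j v ρ → subst j v (after ρ) ≡ after (substRedex j v ρ)
subst-after j v (redex E H s) = cong (λ f → app f (subst j v s)) (begin
  subst j v (plugE E (lam (plugH H (shift 0 d s))))
    ≡⟨ subst-plugE j v E _ ⟩
  plugE E' (lam (subst (suc (bindE E + j)) v' (plugH H (shift 0 d s))))
    ≡⟨ cong (plugE E' ∘ lam) (subst-plugH _ v' H (shift 0 d s)) ⟩
  plugE E' (lam (plugH H' (subst (k + suc (bindE E + j)) (shift 0 k v') (shift 0 d s))))
    ≡⟨ cong₂ (λ i w → plugE E' (lam (plugH H' (subst i w (shift 0 d s)))))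
             (m+1+[n+o]≡n+1+m+o k (bindE E) j) (shift-shift-suc k (bindE E) v) ⟩
  plugE E' (lam (plugH H' (subst (d + j) (shift 0 d v) (shift 0 d s))))
    ≡⟨ cong (plugE E' ∘ lam ∘ plugH H') (subst-shift-comm 0 d j v s z≤n) ⟩
  plugE E' (lam (plugH H' (shift 0 d (subst j v s))))
    ≡⟨ cong₂ (λ b b' → plugE E' (lam (plugH H' (shift 0 (b + suc b') (subst j v s)))))
             (bindE-substE j v E) (bindH-substH _ v' H) ⟨
  plugE E' (lam (plugH H' (shift 0 (bindE E' + suc (bindH H')) (subst j v s)))) ∎)
  where
    open ≡-Reasoning
    k = bindH H
    d = bindE E + suc k
    v' = shift 0 1 (shift 0 (bindE E) v)
    E' = substE j v E
    H' = substH (suc (bindE E + j)) v' H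

m+1+n≤o+1+m : ∀ m {n o} → n ≤ o → m + suc n ≤ o + suc m
m+1+n≤o+1+m m {n} {o} n≤o =
  ≤-trans (+-monoʳ-≤ m (s≤s n≤o)) (≤-reflexive (trans (+-comm m (suc o)) (sym (+-suc o m))))

-- Contracting the head redex of E consumes one of its binders; seen from the hole,
-- that binder has de Bruijn index `index`.
record Contraction (E : ECtx) : Set where
  field
    residual : ECtx
    index    : ℕ
    value    : Term
    bindE≡   : bindE E ≡ suc (bindE residual)
    index≤   : index ≤ bindE residual
    step     : ∀ w → plugE E w →a plugE residual (subst index value w)

contract : ∀ E₁ E₂ t → Contraction (eapp E₁ E₂ t)
contract □ E₂ t = record
  { residual = substE 0 t E₂
  ; index    = bindE E₂ + 0
  ; value    = shift 0 (bindE E₂) t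
  ; bindE≡   = cong suc (sym (bindE-substE 0 t E₂))
  ; index≤   = ≤-reflexive (trans (+-identityʳ _) (sym (bindE-substE 0 t E₂)))
  ; step     = λ w → ≡-subst (app (lam (plugE E₂ w)) t →a_) (subst-plugE 0 t E₂ w) β
  }
contract (eapp E₁₁ E₁₂ t₁) E₂ t = record
  { residual = eapp residual E₂' t
  ; index    = bindE E₂ + suc index
  ; value    = shift 0 (bindE E₂) (shift 0 1 value)
  ; bindE≡   = cong₂ (λ b₁ b₂ → b₁ + suc b₂) bindE≡ (sym (bindE-substE _ _ E₂))
  ; index≤   = ≡-subst (λ b → bindE E₂ + suc index ≤ bindE residual + suc b)
                 (sym (bindE-substE _ _ E₂)) (m+1+n≤o+1+m (bindE E₂) index≤)
  ; step     = λ w → appL (≡-subst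
                 (λ u → plugE (eapp E₁₁ E₁₂ t₁) (lam (plugE E₂ w)) →a plugE residual (lam u))
                 (subst-plugE (suc index) (shift 0 1 value) E₂ w) (step (lam (plugE E₂ w))))
  }
  where
    open Contraction (contract E₁₁ E₁₂ t₁)
    E₂' = substE (suc index) (shift 0 1 value) E₂

record Site : Set where
  constructor _⟦_⟧
  field
    outer : HCtx
    inner : LinearRedex

open LinearRedex using (spine)

source target : Site → Term
source (H ⟦ ρ ⟧) = plugH H (before ρ)
target (H ⟦ ρ ⟧) = plugH H (after ρ)

weight : Site → ℕ
weight (H ⟦ ρ ⟧) = sizeH H + bindE (spine ρ)

data Lockstep (σ : Site) : Set where
  meet    : ∀ {w} → source σ →h w → target σ →h w → Lockstep σ
  advance : ∀ σ' → source σ →h source σ' → target σ →h target σ' →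
            weight σ' < weight σ → Lockstep σ

subst-occurrence≡subst-copy : ∀ H s →
  subst 0 s (plugH H (var (bindH H))) ≡ subst 0 s (plugH H (shift 0 (suc (bindH H)) s))
subst-occurrence≡subst-copy H s = begin
  subst 0 s (plugH H (var k))
    ≡⟨ subst-plugH 0 s H (var k) ⟩
  plugH H' (subst (k + 0) s' (var k))
    ≡⟨ cong (plugH H') occurrence ⟩
  plugH H' s'
    ≡⟨ cong (plugH H') (subst-shift-gap 0 (k + 0) k s' s z≤n (≤-reflexive (+-identityʳ k))) ⟨
  plugH H' (subst (k + 0) s' (shift 0 (suc k) s))
    ≡⟨ subst-plugH 0 s H (shift 0 (suc k) s) ⟨
  subst 0 s (plugH H (shift 0 (suc k) s)) ∎
  where
    open ≡-Reasoning
    k = bindH H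
    s' = shift 0 k s
    H' = substH 0 s H

    occurrence : subst (k + 0) s' (var k) ≡ s'
    occurrence = trans (cong (subst (k + 0) s' ∘ var) (sym (+-identityʳ k))) (subst-var-≡ {k + 0})

lockstep-β : ∀ H s → Lockstep (□ ⟦ redex □ H s ⟧)
lockstep-β H s =
  meet (base (≡-subst (before (redex □ H s) →a_) (subst-occurrence≡subst-copy H s) β)) (base β)

lockstep-contract : ∀ E₁ E₂ t H s → Lockstep (□ ⟦ redex (eapp E₁ E₂ t) H s ⟧)
lockstep-contract E₁ E₂ t H s =
  advance (□ ⟦ redex residual H' s ⟧)
    (base (appL (contracted (plugH H (var k)) occurrence)))
    (base (appL (contracted (plugH H (shift 0 (bindE (eapp E₁ E₂ t) + suc k) s)) copy)))
    (≤-reflexive (sym bindE≡))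
  where
    open Contraction (contract E₁ E₂ t)
    open ≡-Reasoning
    k = bindH H
    v' = shift 0 k (shift 0 1 value)
    H' = substH (suc index) (shift 0 1 value) H

    contracted : ∀ X {Y} → subst (suc index) (shift 0 1 value) X ≡ Y →
      plugE (eapp E₁ E₂ t) (lam X) →a plugE residual (lam Y)
    contracted X eq =
      ≡-subst (λ u → plugE (eapp E₁ E₂ t) (lam X) →a plugE residual (lam u)) eq (step (lam X))

    occurrence : subst (suc index) (shift 0 1 value) (plugH H (var k)) ≡ plugH H' (var (bindH H'))
    occurrence = begin
      subst (suc index) (shift 0 1 value) (plugH H (var k))
        ≡⟨ subst-plugH _ _ H (var k) ⟩
      plugH H' (subst (k + suc index) v' (var k))
        ≡⟨ cong (plugH H') (subst-var-< (m<m+n k z<s)) ⟩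
      plugH H' (var k)
        ≡⟨ cong (plugH H' ∘ var) (bindH-substH _ _ H) ⟨
      plugH H' (var (bindH H')) ∎

    copy : subst (suc index) (shift 0 1 value) (plugH H (shift 0 (bindE (eapp E₁ E₂ t) + suc k) s))
         ≡ plugH H' (shift 0 (bindE residual + suc (bindH H')) s)
    copy = begin
      subst (suc index) (shift 0 1 value) (plugH H (shift 0 (bindE (eapp E₁ E₂ t) + suc k) s))
        ≡⟨ subst-plugH _ _ H _ ⟩
      plugH H' (subst (k + suc index) v' (shift 0 (bindE (eapp E₁ E₂ t) + suc k) s))
        ≡⟨ cong (λ b → plugH H' (subst (k + suc index) v' (shift 0 (b + suc k) s))) bindE≡ ⟩
      plugH H' (subst (k + suc index) v' (shift 0 (suc (bindE residual + suc k)) s))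
        ≡⟨ cong (plugH H') (subst-shift-gap 0 _ _ v' s z≤n (m+1+n≤o+1+m k index≤)) ⟩
      plugH H' (shift 0 (bindE residual + suc k) s)
        ≡⟨ cong (λ b → plugH H' (shift 0 (bindE residual + suc b) s)) (bindH-substH _ _ H) ⟨
      plugH H' (shift 0 (bindE residual + suc (bindH H')) s) ∎

β-outer : ∀ K u {f : LinearRedex → Term} →
  (∀ j v ρ → subst j v (f ρ) ≡ f (substRedex j v ρ)) → ∀ ρ →
  app (lam (plugH K (f ρ))) u →h plugH (substH 0 u K) (f (substRedex (bindH K + 0) (shift 0 (bindH K) u) ρ))
β-outer K u {f} subst-f ρ = base (≡-subst (app (lam (plugH K (f ρ))) u →a_)
  (trans (subst-plugH 0 u K (f ρ)) (cong (plugH (substH 0 u K)) (subst-f _ _ ρ))) β)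

lockstep-outer-β : ∀ K u ρ → Lockstep (happ (hlam K) u ⟦ ρ ⟧)
lockstep-outer-β K u ρ =
  advance (substH 0 u K ⟦ substRedex (bindH K + 0) (shift 0 (bindH K) u) ρ ⟧)
    (β-outer K u subst-before ρ) (β-outer K u subst-after ρ)
    (≤-trans (s≤s (≤-reflexive (cong₂ _+_ (sizeH-substH 0 u K) (bindE-substE _ _ (spine ρ)))))
             (n≤1+n _))

under-lam : ∀ {K ρ} → Lockstep (K ⟦ ρ ⟧) → Lockstep (hlam K ⟦ ρ ⟧)
under-lam (meet a b)                   = meet (lamH a) (lamH b)
under-lam (advance (K ⟦ ρ ⟧) a b lt) = advance (hlam K ⟦ ρ ⟧) (lamH a) (lamH b) (s≤s lt)

appˡ-→h : ∀ {f x w} u → app f x →h w → app (app f x) u →h app w u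
appˡ-→h u (base r) = base (appL r)

under-appˡ : ∀ {K ρ} u → Lockstep (K ⟦ ρ ⟧) →
  (∀ {w} → source (K ⟦ ρ ⟧) →h w → app (source (K ⟦ ρ ⟧)) u →h app w u) →
  (∀ {w} → target (K ⟦ ρ ⟧) →h w → app (target (K ⟦ ρ ⟧)) u →h app w u) →
  Lockstep (happ K u ⟦ ρ ⟧)
under-appˡ u (meet a b)                   liftˢ liftᵗ = meet (liftˢ a) (liftᵗ b)
under-appˡ u (advance (K ⟦ ρ ⟧) a b lt) liftˢ liftᵗ =
  advance (happ K u ⟦ ρ ⟧) (liftˢ a) (liftᵗ b) (s≤s lt)

lockstep : ∀ σ → Lockstep σ
lockstep (□ ⟦ redex □ H s ⟧)              = lockstep-β H s
lockstep (□ ⟦ redex (eapp E₁ E₂ t) H s ⟧) = lockstep-contract E₁ E₂ t H s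
lockstep (hlam K ⟦ ρ ⟧)                    = under-lam (lockstep (K ⟦ ρ ⟧))
lockstep (happ (hlam K) u ⟦ ρ ⟧)           = lockstep-outer-β K u ρ
lockstep (happ □ u ⟦ ρ ⟧)                  =
  under-appˡ u (lockstep (□ ⟦ ρ ⟧)) (appˡ-→h u) (appˡ-→h u)
lockstep (happ (happ K t) u ⟦ ρ ⟧)         =
  under-appˡ u (lockstep (happ K t ⟦ ρ ⟧)) (appˡ-→h u) (appˡ-→h u)

_↓_ : Term → Term → Set
t ↓ u = ∃ λ w → Star _→h_ t w × Star _→h_ u w

site-joinable : ∀ σ → source σ ↓ target σ
site-joinable σ = go σ (<-wellFounded (weight σ))
  where
    go : ∀ σ → Acc _<_ (weight σ) → source σ ↓ target σ
    go σ (acc rs) with lockstep σ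
    ... | meet a b = _ , a ◅ ε , b ◅ ε
    ... | advance σ' a b lt with go σ' (rs lt)
    ...   | w , p , q = w , a ◅ p , b ◅ q

compH : HCtx → HCtx → HCtx
compH □          K = K
compH (hlam H)   K = hlam (compH H K)
compH (happ H t) K = happ (compH H K) t

plugH-compH : ∀ H K u → plugH (compH H K) u ≡ plugH H (plugH K u)
plugH-compH □          K u = refl
plugH-compH (hlam H)   K u = cong lam (plugH-compH H K u)
plugH-compH (happ H t) K u = cong (λ f → app f t) (plugH-compH H K u)

⊸h-site : ∀ {t u} → t ⊸h u → ∃ λ σ → source σ ≡ t × target σ ≡ u
⊸h-site (root E H s) = □ ⟦ redex E H s ⟧ , refl , refl
⊸h-site (ctx H r) with ⊸h-site r
... | K ⟦ ρ ⟧ , refl , refl =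
  compH H K ⟦ ρ ⟧ , plugH-compH H K (before ρ) , plugH-compH H K (after ρ)

⊸h⇒↓ : ∀ {t u} → t ⊸h u → t ↓ u
⊸h⇒↓ r with ⊸h-site r
... | σ , refl , refl = site-joinable σ

→a-deterministic : Deterministic _≡_ _→a_
→a-deterministic β        β        = refl
→a-deterministic (appL r) (appL r') = cong (λ f → app f _) (→a-deterministic r r')

→h-deterministic : Deterministic _≡_ _→h_
→h-deterministic (base r) (base r') = →a-deterministic r r'
→h-deterministic (lamH r) (lamH r') = cong lam (→h-deterministic r r')

↓-trans : ∀ {t u v} → t ↓ u → u ↓ v → t ↓ v
↓-trans (w₁ , t↠w₁ , u↠w₁) (w₂ , u↠w₂ , v↠w₂)
  with det⇒conf →h-deterministic u↠w₁ u↠w₂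
... | w , w₁↠w , w₂↠w = w , t↠w₁ ◅◅ w₁↠w , v↠w₂ ◅◅ w₂↠w

proposition16 : ∀ (t s : Term) → Star _⊸h_ t s →
    ∃ λ s' → Star _→h_ t s' × Star _→h_ s s'
proposition16 t s = fold _↓_ (λ r → ↓-trans (⊸h⇒↓ r)) (λ {t} → t , ε , ε)
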